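{- Let $d,r\ge1$, let $\lambda$ be a partition with $dr$ boxes and at most $\min(d^2,r^2)$ rows, and let $\delta=(d,\dots,d)$ ($r$ parts). Then $t^\lambda_{\delta,\delta}>0$.
   Context: $\alpha^T$ denotes the vector of column lengths of a partition $\alpha$. For finite $P\subseteq\mathbb{N}^3$ the marginals are $(x_P,y_P,z_P)$ with $x_P(i)$ the number of points of $P$ with $x$-coordinate $i$, etc.; $t^\lambda_{\mu,\pi}$ is the number of finite $P\subseteq\mathbb{N}^3$ with marginals $(\lambda^T,\mu^T,\pi^T)$. -}

module Defs where

open import Data.Nat using (ℕ; _<_; _≥_; _≟_; _<?_; _*_; _≤_; _⊓_)
open import Data.Product using (_×_; _,_; proj₁; proj₂; Σ; ∃)
open import Data.List using (List; length; filter; replicate)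
open import Data.List.Relation.Unary.All using (All)
open import Data.List.Relation.Unary.Linked using (Linked)
open import Data.List.Relation.Unary.Unique.Propositional using (Unique)
open import Relation.Binary.PropositionalEquality using (_≡_)

IsPartition : List ℕ → Set
IsPartition α = All (0 <_) α × Linked _≥_ α

-- Conjugate partition as a sequence: α^T(i) = number of parts of α that are > i
-- (column lengths, columns indexed from 0; zero beyond the first row).
conj : List ℕ → ℕ → ℕ
conj α i = length (filter (i <?_) α)

Point : Set
Point = ℕ × ℕ × ℕ

xMarg : List Point → ℕ → ℕ
xMarg P i = length (filter (λ p → proj₁ p ≟ i) P)

yMarg : List Point → ℕ → ℕ
yMarg P j = length (filter (λ p → proj₁ (proj₂ p) ≟ j) P)

zMarg : List Point → ℕ → ℕ
zMarg P k = length (filter (λ p → proj₂ (proj₂ p) ≟ k) P)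

HasMarginals : List Point → (ℕ → ℕ) → (ℕ → ℕ) → (ℕ → ℕ) → Set
HasMarginals P a b c = (∀ i → xMarg P i ≡ a i) × (∀ j → yMarg P j ≡ b j) × (∀ k → zMarg P k ≡ c k)

-- t^λ_{μ,π} > 0 : there is a finite P ⊆ ℕ³ with marginals (λ^T, μ^T, π^T).
tPositive : List ℕ → List ℕ → List ℕ → Set
tPositive λ' μ π = Σ (List Point) (λ P → Unique P × HasMarginals P (conj λ') (conj μ) (conj π))

rect : ℕ → ℕ → List ℕ
rect d r = replicate r d

module Submission where

-- Write d for the common part of δ and c = λᵀ for the column lengths of λ.
-- Enumerate the d·r boxes of λ column by column by a counter t = 0, 1, …,
-- so that column i receives a block of c i consecutive values of t, and send
-- the box numbered t in column i to the point (i , cell t) ∈ ℕ³, where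
--   cell t = (s , (s + q) mod d)   for   t = q·d + s,  s < d.
-- * x-marginal: column i contributes exactly c i points with x = i.
-- * y/z-marginals: the counter runs over [0, r·d), i.e. over r aligned blocks
--   of length d; in each block both coordinates of cell run once through all
--   residues mod d, so each value j < d occurs r = δᵀ(j) times.
-- * distinctness: every column has at most d² boxes (λ has at most d² rows),
--   and cell is injective on every window of d² consecutive counters.
-- The file first develops counting in lists and integer intervals, then
-- conjugate partitions, then the map cell, then the column-by-column sweep for
-- an arbitrary cell map; the theorem combines these.

open import Defs
open import Data.Nat using (ℕ; zero; suc; _+_; _*_; _⊓_; _≤_; _<_; _≟_; _<?_; z≤n; s≤s; s<s; NonZero; >-nonZero; _%_; _/_)
open import Data.Nat.Properties
open import Data.Nat.DivMod
open import Data.Nat.Divisibility using (divides)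
open import Data.Nat.ListAction using (sum)
open import Data.List using (List; []; _∷_; _++_; length; map; filter)
open import Data.List.Properties
  using (length-++; map-++; map-∘; map-cong-local; filter-++; filter-all; filter-none; filter-accept; filter-reject; length-filter)
open import Data.List.Relation.Unary.All as All using (All; []; _∷_)
import Data.List.Relation.Unary.All.Properties as AllP
open import Data.List.Relation.Unary.AllPairs using (AllPairs; []; _∷_)
import Data.List.Relation.Unary.AllPairs.Properties as AllPairsP
open import Data.List.Relation.Unary.Unique.Propositional using (Unique)
open import Data.Product using (_×_; _,_; proj₁; proj₂)
open import Data.Bool using (true; false)
open import Relation.Nullary using (yes; no; does)
open import Relation.Binary.Definitions using (Tri; tri<; tri≈; tri>)
open import Relation.Binary.PropositionalEquality
  using (_≡_; _≢_; refl; sym; trans; cong; cong₂; subst; subst₂; module ≡-Reasoning)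
open import Function using (_∘_; id)
open import Algebra.Properties.CommutativeSemigroup +-commutativeSemigroup using (interchange)

-- Number of entries of xs on which f takes the value k; all three marginals
-- of Defs are instances (definitionally).
count : {A : Set} → (A → ℕ) → ℕ → List A → ℕ
count f k xs = length (filter (λ x → f x ≟ k) xs)

count-++ : {A : Set} (f : A → ℕ) (k : ℕ) (xs ys : List A) →
  count f k (xs ++ ys) ≡ count f k xs + count f k ys
count-++ f k xs ys =
  trans (cong length (filter-++ (λ x → f x ≟ k) xs ys)) (length-++ (filter (λ x → f x ≟ k) xs))

count-map : {A B : Set} (f : B → ℕ) (g : A → B) (k : ℕ) (xs : List A) →
  count f k (map g xs) ≡ count (f ∘ g) k xs
count-map f g k [] = refl
count-map f g k (x ∷ xs) with does (f (g x) ≟ k)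
... | true = cong suc (count-map f g k xs)
... | false = count-map f g k xs

count-cong : {A : Set} (f g : A → ℕ) (k : ℕ) {xs : List A} →
  All (λ x → f x ≡ g x) xs → count f k xs ≡ count g k xs
count-cong f g k {xs} f≡g = begin
  count f k xs           ≡⟨ count-map id f k xs ⟨
  count id k (map f xs)  ≡⟨ cong (count id k) (map-cong-local f≡g) ⟩
  count id k (map g xs)  ≡⟨ count-map id g k xs ⟩
  count g k xs           ∎
  where open ≡-Reasoning

count-none : {A : Set} (f : A → ℕ) (k : ℕ) {xs : List A} → All (λ x → f x ≢ k) xs → count f k xs ≡ 0
count-none f k f≢k = cong length (filter-none (λ x → f x ≟ k) f≢k)

count-const-≡ : {A : Set} (k : ℕ) (xs : List A) → count (λ _ → k) k xs ≡ length xs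
count-const-≡ k xs = cong length (filter-all (λ _ → k ≟ k) (All.universal (λ _ → refl) xs))

count-const-≢ : {A : Set} {i k : ℕ} (xs : List A) → i ≢ k → count (λ _ → i) k xs ≡ 0
count-const-≢ {i = i} {k} xs i≢k = count-none (λ _ → i) k (All.universal (λ _ → i≢k) xs)

count-singleton-cong : {A : Set} (f : A → ℕ) (k : ℕ) {a b : A} → f a ≡ f b → count f k (a ∷ []) ≡ count f k (b ∷ [])
count-singleton-cong f k {a} {b} fa≡fb = begin
  count f k (a ∷ [])     ≡⟨ count-map id f k (a ∷ []) ⟨
  count id k (f a ∷ [])  ≡⟨ cong (λ v → count id k (v ∷ [])) fa≡fb ⟩
  count id k (f b ∷ [])  ≡⟨ count-map id f k (b ∷ []) ⟩
  count f k (b ∷ [])     ∎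
  where open ≡-Reasoning

interval : ℕ → ℕ → List ℕ
interval s zero = []
interval s (suc n) = s ∷ interval (suc s) n

length-interval : ∀ s n → length (interval s n) ≡ n
length-interval s zero = refl
length-interval s (suc n) = cong suc (length-interval (suc s) n)

interval-++ : ∀ s m n → interval s (m + n) ≡ interval s m ++ interval (s + m) n
interval-++ s zero n = cong (λ u → interval u n) (sym (+-identityʳ s))
interval-++ s (suc m) n =
  cong (s ∷_) (trans (interval-++ (suc s) m n) (cong (λ u → interval (suc s) m ++ interval u n) (sym (+-suc s m))))

interval-snoc : ∀ s n → interval s (suc n) ≡ interval s n ++ (s + n ∷ [])
interval-snoc s n = trans (cong (interval s) (+-comm 1 n)) (interval-++ s n 1)

interval-shift : ∀ a s n → interval (a + s) n ≡ map (a +_) (interval s n)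
interval-shift a s zero = refl
interval-shift a s (suc n) =
  cong (a + s ∷_) (trans (cong (λ u → interval u n) (sym (+-suc a s))) (interval-shift a (suc s) n))

interval-from-0 : ∀ a n → interval a n ≡ map (a +_) (interval 0 n)
interval-from-0 a n = trans (cong (λ u → interval u n) (sym (+-identityʳ a))) (interval-shift a 0 n)

interval-bounds : ∀ s n → All (λ t → s ≤ t × t < s + n) (interval s n)
interval-bounds s zero = []
interval-bounds s (suc n) rewrite +-suc s n =
  (≤-refl , s<s (m≤m+n s n)) ∷ All.map (λ (s<t , t<) → <⇒≤ s<t , t<) (interval-bounds (suc s) n)

interval-allPairs : {R : ℕ → ℕ → Set} → ∀ s n →
  (∀ {t t'} → s ≤ t → t < t' → t' < s + n → R t t') → AllPairs R (interval s n)
interval-allPairs s zero R-ordered = []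
interval-allPairs s (suc n) R-ordered rewrite +-suc s n =
  All.map (λ (s<t' , t'<) → R-ordered ≤-refl s<t' t'<) (interval-bounds (suc s) n)
  ∷ interval-allPairs (suc s) n (λ s<t → R-ordered (<⇒≤ s<t))

𝟙[_<_] : ℕ → ℕ → ℕ
𝟙[ _ < zero ] = 0
𝟙[ zero < suc _ ] = 1
𝟙[ suc j < suc n ] = 𝟙[ j < n ]

𝟙-< : ∀ {j n} → j < n → 𝟙[ j < n ] ≡ 1
𝟙-< {zero} {suc n} _ = refl
𝟙-< {suc j} {suc n} (s≤s j<n) = 𝟙-< j<n

𝟙-≥ : ∀ {j n} → n ≤ j → 𝟙[ j < n ] ≡ 0
𝟙-≥ {j} {zero} _ = refl
𝟙-≥ {suc j} {suc n} (s≤s n≤j) = 𝟙-≥ n≤j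

count-initial-segment : ∀ j n → count id j (interval 0 n) ≡ 𝟙[ j < n ]
count-initial-segment j zero = refl
count-initial-segment j (suc n) = begin
  count id j (interval 0 (suc n))                  ≡⟨ cong (count id j) (interval-snoc 0 n) ⟩
  count id j (interval 0 n ++ (n ∷ []))             ≡⟨ count-++ id j (interval 0 n) (n ∷ []) ⟩
  count id j (interval 0 n) + count id j (n ∷ [])  ≡⟨ cong (_+ count id j (n ∷ [])) (count-initial-segment j n) ⟩
  𝟙[ j < n ] + count id j (n ∷ [])                 ≡⟨ last-step (<-cmp j n) ⟩
  𝟙[ j < suc n ]                                   ∎
  where
  open ≡-Reasoning
  last-step : Tri (j < n) (j ≡ n) (n < j) → 𝟙[ j < n ] + count id j (n ∷ []) ≡ 𝟙[ j < suc n ]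
  last-step (tri< j<n j≢n _) rewrite 𝟙-< j<n | 𝟙-< (m<n⇒m<1+n j<n) =
    cong (suc ∘ length) (filter-reject (λ x → x ≟ j) (j≢n ∘ sym))
  last-step (tri≈ _ refl _) rewrite 𝟙-≥ (≤-refl {j}) | 𝟙-< (n<1+n j) =
    cong length (filter-accept (λ x → x ≟ j) refl)
  last-step (tri> _ j≢n n<j) rewrite 𝟙-≥ (<⇒≤ n<j) | 𝟙-≥ n<j =
    cong length (filter-reject (λ x → x ≟ j) (j≢n ∘ sym))

conj-∷ : ∀ a α i → conj (a ∷ α) i ≡ 𝟙[ i < a ] + conj α i
conj-∷ a α i with i <? a
... | yes i<a rewrite 𝟙-< i<a = cong length (filter-accept (i <?_) i<a)
... | no i≮a rewrite 𝟙-≥ (≮⇒≥ i≮a) = cong length (filter-reject (i <?_) i≮a)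

conj-rect : ∀ d r j → conj (rect d r) j ≡ r * 𝟙[ j < d ]
conj-rect d zero j = refl
conj-rect d (suc r) j = trans (conj-∷ d (rect d r) j) (cong (𝟙[ j < d ] +_) (conj-rect d r j))

conj-vanishes : ∀ α {M m} → All (_≤ M) α → M ≤ m → conj α m ≡ 0
conj-vanishes [] _ _ = refl
conj-vanishes (a ∷ α) {m = m} (a≤M ∷ α≤M) M≤m =
  trans (conj-∷ a α m) (cong₂ _+_ (𝟙-≥ (≤-trans a≤M M≤m)) (conj-vanishes α α≤M M≤m))

conj-≤-length : ∀ α i → conj α i ≤ length α
conj-≤-length α i = length-filter (i <?_) α

parts-≤-sum : ∀ α → All (_≤ sum α) α
parts-≤-sum [] = []
parts-≤-sum (a ∷ α) = m≤m+n a (sum α) ∷ All.map (λ a'≤ → ≤-trans a'≤ (m≤n+m (sum α) a)) (parts-≤-sum α)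

sum-map-+ : (f g : ℕ → ℕ) (xs : List ℕ) →
  sum (map (λ x → f x + g x) xs) ≡ sum (map f xs) + sum (map g xs)
sum-map-+ f g [] = refl
sum-map-+ f g (x ∷ xs) =
  trans (cong (f x + g x +_) (sum-map-+ f g xs)) (interchange (f x) (g x) (sum (map f xs)) (sum (map g xs)))

sum-map-0 : {A : Set} (xs : List A) → sum (map (λ _ → 0) xs) ≡ 0
sum-map-0 [] = refl
sum-map-0 (x ∷ xs) = sum-map-0 xs

sum-𝟙 : ∀ a M → a ≤ M → sum (map (λ i → 𝟙[ i < a ]) (interval 0 M)) ≡ a
sum-𝟙 zero M _ = sum-map-0 (interval 0 M)
sum-𝟙 (suc a) (suc M) (s≤s a≤M) = cong suc (begin
  sum (map (λ i → 𝟙[ i < suc a ]) (interval 1 M))          ≡⟨ cong (sum ∘ map (λ i → 𝟙[ i < suc a ])) (interval-from-0 1 M) ⟩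
  sum (map (λ i → 𝟙[ i < suc a ]) (map suc (interval 0 M))) ≡⟨ cong sum (map-∘ (interval 0 M)) ⟨
  sum (map (λ i → 𝟙[ i < a ]) (interval 0 M))              ≡⟨ sum-𝟙 a M a≤M ⟩
  a                                                        ∎)
  where open ≡-Reasoning

sum-conj : ∀ α M → All (_≤ M) α → sum (map (conj α) (interval 0 M)) ≡ sum α
sum-conj [] M _ = sum-map-0 (interval 0 M)
sum-conj (a ∷ α) M (a≤M ∷ α≤M) = begin
  sum (map (conj (a ∷ α)) (interval 0 M))                          ≡⟨ cong sum (map-cong-local (All.universal (conj-∷ a α) (interval 0 M))) ⟩
  sum (map (λ i → 𝟙[ i < a ] + conj α i) (interval 0 M))            ≡⟨ sum-map-+ (λ i → 𝟙[ i < a ]) (conj α) (interval 0 M) ⟩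
  sum (map (λ i → 𝟙[ i < a ]) (interval 0 M)) + sum (map (conj α) (interval 0 M)) ≡⟨ cong₂ _+_ (sum-𝟙 a M a≤M) (sum-conj α M α≤M) ⟩
  a + sum α                                                        ∎
  where open ≡-Reasoning

count-slide : (f : ℕ → ℕ) (k a n : ℕ) → f a ≡ f (suc a + n) →
  count f k (interval a (suc n)) ≡ count f k (interval (suc a) (suc n))
count-slide f k a n fa≡ = begin
  count f k ((a ∷ []) ++ interval (suc a) n)                       ≡⟨ count-++ f k (a ∷ []) (interval (suc a) n) ⟩
  count f k (a ∷ []) + count f k (interval (suc a) n)              ≡⟨ +-comm (count f k (a ∷ [])) _ ⟩
  count f k (interval (suc a) n) + count f k (a ∷ [])              ≡⟨ cong (count f k (interval (suc a) n) +_) (count-singleton-cong f k fa≡) ⟩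
  count f k (interval (suc a) n) + count f k (suc a + n ∷ [])      ≡⟨ count-++ f k (interval (suc a) n) (suc a + n ∷ []) ⟨
  count f k (interval (suc a) n ++ (suc a + n ∷ []))               ≡⟨ cong (count f k) (interval-snoc (suc a) n) ⟨
  count f k (interval (suc a) (suc n))                             ∎
  where open ≡-Reasoning

residues-in-window : ∀ n .{{_ : NonZero n}} a j → count (_% n) j (interval a n) ≡ 𝟙[ j < n ]
residues-in-window n@(suc m) zero j =
  trans (count-cong (_% n) id j (All.map (λ (_ , t<n) → m<n⇒m%n≡m t<n) (interval-bounds 0 n)))
        (count-initial-segment j n)
residues-in-window n@(suc m) (suc a) j =
  trans (sym (count-slide (_% n) j a m a≡a+n)) (residues-in-window n a j)
  where
  a≡a+n : a % n ≡ (suc a + m) % n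
  a≡a+n = sym (trans (cong (_% n) (sym (+-suc a m))) ([m+n]%n≡m%n a n))

count-blocks : (f : ℕ → ℕ) (k d v : ℕ) → (∀ q → count f k (interval (q * d) d) ≡ v) →
  ∀ q r → count f k (interval (q * d) (r * d)) ≡ r * v
count-blocks f k d v per-block q zero = refl
count-blocks f k d v per-block q (suc r) = begin
  count f k (interval (q * d) (d + r * d))                                     ≡⟨ cong (count f k) (interval-++ (q * d) d (r * d)) ⟩
  count f k (interval (q * d) d ++ interval (q * d + d) (r * d))               ≡⟨ count-++ f k (interval (q * d) d) _ ⟩
  count f k (interval (q * d) d) + count f k (interval (q * d + d) (r * d))    ≡⟨ cong₂ _+_ (per-block q) (cong (λ u → count f k (interval u (r * d))) (+-comm (q * d) d)) ⟩
  v + count f k (interval (suc q * d) (r * d))                                 ≡⟨ cong (v +_) (count-blocks f k d v per-block (suc q) r) ⟩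
  v + r * v                                                                    ∎
  where open ≡-Reasoning

residues-distinct : ∀ n .{{_ : NonZero n}} {a b} → a < b → b < a + n → a % n ≢ b % n
residues-distinct n {a} {b} a<b b<a+n a≡b = <⇒≱ b<a+n (begin
  a + n                        ≡⟨ cong (_+ n) (m≡m%n+[m/n]*n a n) ⟩
  a % n + a / n * n + n        ≡⟨ +-assoc (a % n) (a / n * n) n ⟩
  a % n + (a / n * n + n)      ≡⟨ cong (a % n +_) (+-comm (a / n * n) n) ⟩
  a % n + suc (a / n) * n      ≤⟨ +-monoʳ-≤ (a % n) (*-monoˡ-≤ n quotients-increase) ⟩
  a % n + b / n * n            ≡⟨ cong (_+ b / n * n) a≡b ⟩
  b % n + b / n * n            ≡⟨ m≡m%n+[m/n]*n b n ⟨
  b                            ∎)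
  where
  open ≤-Reasoning
  b≡ : b ≡ a % n + b / n * n
  b≡ = trans (m≡m%n+[m/n]*n b n) (cong (_+ b / n * n) (sym a≡b))
  quotients-increase : a / n < b / n
  quotients-increase = *-cancelʳ-< n (a / n) (b / n)
    (+-cancelˡ-< (a % n) _ _ (subst₂ _<_ (m≡m%n+[m/n]*n a n) b≡ a<b))

WindowInjective : {B : Set} → (ℕ → B) → ℕ → Set
WindowInjective f w = ∀ {t t'} → t < t' → t' < t + w → f t ≢ f t'

-- The cell of counter t = q·d + s (s < d) is (s , (s + q) mod d): the q-th
-- block of d counters traverses the q-th cyclically shifted diagonal of d × d.
module Cells (d : ℕ) .{{_ : NonZero d}} where

  cell : ℕ → ℕ × ℕ
  cell t = t % d , (t % d + t / d) % d

  cell-in-block : ∀ q {s} → s < d → cell (q * d + s) ≡ (s , (q + s) % d)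
  cell-in-block q {s} s<d = cong₂ _,_ remainder (cong (_% d) (trans (cong₂ _+_ remainder quotient) (+-comm s q)))
    where
    remainder : (q * d + s) % d ≡ s
    remainder = trans (cong (_% d) (+-comm (q * d) s)) (trans ([m+kn]%n≡m%n s q d) (m<n⇒m%n≡m s<d))
    quotient : (q * d + s) / d ≡ q
    quotient = trans (+-distrib-/-∣ˡ s (divides q refl))
                     (trans (cong₂ _+_ (m*n/n≡m q d) (m<n⇒m/n≡0 s<d)) (+-identityʳ q))

  -- Within d² consecutive counters the cells are distinct: equal first
  -- coordinates force t' = t + (q' - q)·d with 0 < q' - q < d, and then the
  -- second coordinates differ by q' - q mod d.
  cell-window-injective : WindowInjective cell (d * d)
  cell-window-injective {t} {t'} t<t' t'<t+dd cell≡ =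
    residues-distinct d (+-monoʳ-< s q<q') (subst (s + q' <_) (sym (+-assoc s q d)) (+-monoʳ-< s q'<q+d)) z≡
    where
    s = t % d
    q = t / d
    q' = t' / d
    y≡ : s ≡ t' % d
    y≡ = cong proj₁ cell≡
    z≡ : (s + q) % d ≡ (s + q') % d
    z≡ = trans (cong proj₂ cell≡) (cong (λ u → (u + q') % d) (sym y≡))
    t≡ : t ≡ s + q * d
    t≡ = m≡m%n+[m/n]*n t d
    t'≡ : t' ≡ s + q' * d
    t'≡ = trans (m≡m%n+[m/n]*n t' d) (cong (_+ q' * d) (sym y≡))
    t+dd≡ : t + d * d ≡ s + (q + d) * d
    t+dd≡ = begin
      t + d * d           ≡⟨ cong (_+ d * d) t≡ ⟩
      s + q * d + d * d   ≡⟨ +-assoc s (q * d) (d * d) ⟩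
      s + (q * d + d * d) ≡⟨ cong (s +_) (*-distribʳ-+ d q d) ⟨
      s + (q + d) * d     ∎
      where open ≡-Reasoning
    q<q' : q < q'
    q<q' = *-cancelʳ-< d q q' (+-cancelˡ-< s _ _ (subst₂ _<_ t≡ t'≡ t<t'))
    q'<q+d : q' < q + d
    q'<q+d = *-cancelʳ-< d q' (q + d) (+-cancelˡ-< s _ _ (subst₂ _<_ t'≡ t+dd≡ t'<t+dd))

  -- Both coordinates of cell run through each residue once per aligned block,
  -- hence r times over the first r·d counters.
  first-coordinate-count : ∀ r j → count (proj₁ ∘ cell) j (interval 0 (r * d)) ≡ r * 𝟙[ j < d ]
  first-coordinate-count r j = count-blocks (_% d) j d 𝟙[ j < d ] (λ q → residues-in-window d (q * d) j) 0 r

  second-coordinate-in-block : ∀ q k → count (proj₂ ∘ cell) k (interval (q * d) d) ≡ 𝟙[ k < d ]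
  second-coordinate-in-block q k = begin
    count (proj₂ ∘ cell) k (interval (q * d) d)                  ≡⟨ cong (count (proj₂ ∘ cell) k) (interval-from-0 (q * d) d) ⟩
    count (proj₂ ∘ cell) k (map (q * d +_) (interval 0 d))       ≡⟨ count-map (proj₂ ∘ cell) (q * d +_) k (interval 0 d) ⟩
    count (λ s → proj₂ (cell (q * d + s))) k (interval 0 d)      ≡⟨ count-cong _ _ k (All.map (λ (_ , s<d) → cong proj₂ (cell-in-block q s<d)) (interval-bounds 0 d)) ⟩
    count (λ s → (q + s) % d) k (interval 0 d)                   ≡⟨ count-map (_% d) (q +_) k (interval 0 d) ⟨
    count (_% d) k (map (q +_) (interval 0 d))                   ≡⟨ cong (count (_% d) k) (interval-from-0 q d) ⟨
    count (_% d) k (interval q d)                                ≡⟨ residues-in-window d q k ⟩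
    𝟙[ k < d ]                                                   ∎
    where open ≡-Reasoning

  second-coordinate-count : ∀ r k → count (proj₂ ∘ cell) k (interval 0 (r * d)) ≡ r * 𝟙[ k < d ]
  second-coordinate-count r k = count-blocks (proj₂ ∘ cell) k d 𝟙[ k < d ] (λ q → second-coordinate-in-block q k) 0 r

module Sweep (cell : ℕ → ℕ × ℕ) (c : ℕ → ℕ) where

  column : ℕ → ℕ → List Point
  column i off = map (λ t → (i , cell t)) (interval off (c i))

  sweep : ℕ → ℕ → ℕ → List Point
  sweep off i zero = []
  sweep off i (suc n) = column i off ++ sweep (off + c i) (suc i) n

  boxes : ℕ → ℕ → ℕ
  boxes i n = sum (map c (interval i n))

  sweep-cells : ∀ off i n → map proj₂ (sweep off i n) ≡ map cell (interval off (boxes i n))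
  sweep-cells off i zero = refl
  sweep-cells off i (suc n) = begin
    map proj₂ (column i off ++ sweep (off + c i) (suc i) n)
      ≡⟨ map-++ proj₂ (column i off) _ ⟩
    map proj₂ (column i off) ++ map proj₂ (sweep (off + c i) (suc i) n)
      ≡⟨ cong₂ _++_ (sym (map-∘ (interval off (c i)))) (sweep-cells (off + c i) (suc i) n) ⟩
    map cell (interval off (c i)) ++ map cell (interval (off + c i) (boxes (suc i) n))
      ≡⟨ map-++ cell (interval off (c i)) _ ⟨
    map cell (interval off (c i) ++ interval (off + c i) (boxes (suc i) n))
      ≡⟨ cong (map cell) (interval-++ off (c i) (boxes (suc i) n)) ⟨
    map cell (interval off (boxes i (suc n)))
      ∎
    where open ≡-Reasoning

  sweep-cell-count : ∀ (f : ℕ × ℕ → ℕ) k off i n →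
    count (f ∘ proj₂) k (sweep off i n) ≡ count (f ∘ cell) k (interval off (boxes i n))
  sweep-cell-count f k off i n = begin
    count (f ∘ proj₂) k (sweep off i n)                ≡⟨ count-map f proj₂ k (sweep off i n) ⟨
    count f k (map proj₂ (sweep off i n))              ≡⟨ cong (count f k) (sweep-cells off i n) ⟩
    count f k (map cell (interval off (boxes i n)))    ≡⟨ count-map f cell k (interval off (boxes i n)) ⟩
    count (f ∘ cell) k (interval off (boxes i n))      ∎
    where open ≡-Reasoning

  column-x-count : ∀ i off m → count proj₁ m (column i off) ≡ count (λ _ → i) m (interval off (c i))
  column-x-count i off m = count-map proj₁ (λ t → (i , cell t)) m (interval off (c i))

  sweep-x-lower-bound : ∀ off i n → All (λ p → i ≤ proj₁ p) (sweep off i n)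
  sweep-x-lower-bound off i zero = []
  sweep-x-lower-bound off i (suc n) =
    AllP.++⁺ (AllP.map⁺ (All.universal (λ _ → ≤-refl) (interval off (c i))))
             (All.map <⇒≤ (sweep-x-lower-bound (off + c i) (suc i) n))

  sweep-x-count : ∀ off i n → (∀ m → i + n ≤ m → c m ≡ 0) → ∀ m → i ≤ m → count proj₁ m (sweep off i n) ≡ c m
  sweep-x-count off i zero c-vanishes m i≤m = sym (c-vanishes m (subst (_≤ m) (sym (+-identityʳ i)) i≤m))
  sweep-x-count off i (suc n) c-vanishes m i≤m with i ≟ m
  ... | yes refl = begin
    count proj₁ i (column i off ++ rest)                     ≡⟨ count-++ proj₁ i (column i off) rest ⟩
    count proj₁ i (column i off) + count proj₁ i rest        ≡⟨ cong₂ _+_ (column-x-count i off i) rest-misses-i ⟩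
    count (λ _ → i) i (interval off (c i)) + 0               ≡⟨ +-identityʳ _ ⟩
    count (λ _ → i) i (interval off (c i))                   ≡⟨ count-const-≡ i (interval off (c i)) ⟩
    length (interval off (c i))                              ≡⟨ length-interval off (c i) ⟩
    c i                                                      ∎
    where
    open ≡-Reasoning
    rest = sweep (off + c i) (suc i) n
    rest-misses-i : count proj₁ i rest ≡ 0
    rest-misses-i = count-none proj₁ i (All.map (λ i<x x≡i → <-irrefl (sym x≡i) i<x) (sweep-x-lower-bound (off + c i) (suc i) n))
  ... | no i≢m = begin
    count proj₁ m (column i off ++ rest)                     ≡⟨ count-++ proj₁ m (column i off) rest ⟩
    count proj₁ m (column i off) + count proj₁ m rest        ≡⟨ cong (_+ count proj₁ m rest) (column-x-count i off m) ⟩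
    count (λ _ → i) m (interval off (c i)) + count proj₁ m rest  ≡⟨ cong (_+ count proj₁ m rest) (count-const-≢ (interval off (c i)) i≢m) ⟩
    count proj₁ m rest                                       ≡⟨ sweep-x-count (off + c i) (suc i) n c-vanishes′ m (≤∧≢⇒< i≤m i≢m) ⟩
    c m                                                      ∎
    where
    open ≡-Reasoning
    rest = sweep (off + c i) (suc i) n
    c-vanishes′ : ∀ m → suc i + n ≤ m → c m ≡ 0
    c-vanishes′ m le = c-vanishes m (subst (_≤ m) (sym (+-suc i n)) le)

  -- If cell is injective on windows of length w and no column is longer than w,
  -- the sweep has no repeated points: within a column the counters lie in one
  -- window, and different columns have different x-coordinates.
  column-unique : ∀ {w} → WindowInjective cell w → ∀ i off → c i ≤ w → Unique (column i off)
  column-unique injective i off cᵢ≤w = AllPairsP.map⁺ (interval-allPairs off (c i)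
    (λ off≤t t<t' t'<end same → injective t<t' (<-≤-trans t'<end (+-mono-≤ off≤t cᵢ≤w)) (cong proj₂ same)))

  sweep-unique : ∀ {w} → WindowInjective cell w → (∀ m → c m ≤ w) → ∀ off i n → Unique (sweep off i n)
  sweep-unique injective c≤w off i zero = []
  sweep-unique injective c≤w off i (suc n) =
    AllPairsP.++⁺ (column-unique injective i off (c≤w i)) (sweep-unique injective c≤w (off + c i) (suc i) n)
      (AllP.map⁺ (All.universal (λ _ → All.map (λ i<x same → <-irrefl (cong proj₁ same) i<x)
        (sweep-x-lower-bound (off + c i) (suc i) n)) (interval off (c i))))

theorem6p9 : (d r : ℕ) → 1 ≤ d → 1 ≤ r → (λ' : List ℕ) → IsPartition λ' →
    sum λ' ≡ d * r → length λ' ≤ (d * d) ⊓ (r * r) →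
    tPositive λ' (rect d r) (rect d r)
theorem6p9 d r 1≤d _ λ' _ |λ'|≡dr rows≤ = P , unique , x-marginal , marginal proj₁ first-coordinate-count , marginal proj₂ second-coordinate-count
  where
  open Cells d {{>-nonZero 1≤d}}
  open Sweep cell (conj λ')
  -- Sweeping the first M = |λ| columns of λ covers all boxes.
  M = sum λ'
  P = sweep 0 0 M
  total : boxes 0 M ≡ r * d
  total = trans (sum-conj λ' M (parts-≤-sum λ')) (trans |λ'|≡dr (*-comm d r))
  columns≤d² : ∀ i → conj λ' i ≤ d * d
  columns≤d² i = ≤-trans (conj-≤-length λ' i) (≤-trans rows≤ (m⊓n≤m (d * d) (r * r)))
  unique = sweep-unique cell-window-injective columns≤d² 0 0 M
  x-marginal : ∀ i → xMarg P i ≡ conj λ' i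
  x-marginal i = sweep-x-count 0 0 M (λ _ → conj-vanishes λ' (parts-≤-sum λ')) i z≤n
  marginal : (f : ℕ × ℕ → ℕ) → (∀ r k → count (f ∘ cell) k (interval 0 (r * d)) ≡ r * 𝟙[ k < d ]) →
    ∀ k → count (f ∘ proj₂) k P ≡ conj (rect d r) k
  marginal f coordinate-count k = begin
    count (f ∘ proj₂) k P                             ≡⟨ sweep-cell-count f k 0 0 M ⟩
    count (f ∘ cell) k (interval 0 (boxes 0 M))       ≡⟨ cong (λ N → count (f ∘ cell) k (interval 0 N)) total ⟩
    count (f ∘ cell) k (interval 0 (r * d))           ≡⟨ coordinate-count r k ⟩
    r * 𝟙[ k < d ]                                    ≡⟨ conj-rect d r k ⟨
    conj (rect d r) k                                 ∎
    where open ≡-Reasoning
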